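{- Let $G$ be a connected $(P_5,\text{banner})$-free graph. Then $cop(G)\leq 2$.
   Context: All graphs are finite, simple and undirected. $P_n$ denotes the path on $n$ vertices. The banner is the graph obtained from a cycle $C_4$ by adding one new vertex adjacent to exactly one vertex of the cycle. A graph is $(H_1,\dots,H_k)$-free if it contains no induced subgraph isomorphic to any $H_i$. Game of cops and robber on a connected graph: first all cops are placed on vertices (several may share a vertex), then the robber chooses a vertex; afterwards cops and robber move alternately, starting with the cops, where a move consists of staying put or moving to an adjacent vertex (on the cops' turn each cop moves). The cops win if after finitely many rounds some cop is on the same vertex as the robber. The cop number $cop(G)$ is the minimum number of cops that guarantees a win in each connected component of $G$. -}

module Defs where

open import Data.Nat using (ℕ; zero; suc; _≤_)
open import Data.Fin using (Fin; toℕ)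
open import Data.Bool using (Bool; true; false; T; _∨_)
open import Data.Bool.Properties using (∨-comm; T?)
open import Data.Product using (Σ; ∃; _×_; _,_)
open import Data.Sum using (_⊎_)
open import Relation.Nullary using (¬_)
open import Relation.Binary using (Decidable)
open import Relation.Binary.PropositionalEquality using (_≡_; subst)
open import Function.Definitions using (Injective)

record Graph : Set₁ where
  field
    n      : ℕ
    Adj    : Fin n → Fin n → Set
    sym    : ∀ {u v} → Adj u v → Adj v u
    irrefl : ∀ {u} → ¬ Adj u u
    adj?   : Decidable Adj

open Graph public

Vertex : Graph → Set
Vertex G = Fin (n G)

data Walk (G : Graph) : Vertex G → Vertex G → Set where
  here : ∀ {u} → Walk G u u
  step : ∀ {u w v} → Adj G u w → Walk G w v → Walk G u v

Connected : Graph → Set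
Connected G = ∀ (u v : Vertex G) → Walk G u v

InducedSubgraph : Graph → Graph → Set
InducedSubgraph H G =
  Σ (Vertex H → Vertex G) λ f →
    Injective _≡_ _≡_ f ×
    (∀ i j → (Adj H i j → Adj G (f i) (f j)) × (Adj G (f i) (f j) → Adj H i j))

Free : Graph → Graph → Set
Free H G = ¬ InducedSubgraph H G

module Small (k : ℕ) (e : ℕ → ℕ → Bool)
             (irr : ∀ (u : Fin k) → ¬ T (e (toℕ u) (toℕ u) ∨ e (toℕ u) (toℕ u))) where
  graph : Graph
  graph = record
    { n      = k
    ; Adj    = λ u v → T (e (toℕ u) (toℕ v) ∨ e (toℕ v) (toℕ u))
    ; sym    = λ {u} {v} p → subst T (∨-comm (e (toℕ u) (toℕ v)) (e (toℕ v) (toℕ u))) p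
    ; irrefl = λ {u} → irr u
    ; adj?   = λ u v → T? (e (toℕ u) (toℕ v) ∨ e (toℕ v) (toℕ u))
    }

p5E : ℕ → ℕ → Bool
p5E 0 1 = true
p5E 1 2 = true
p5E 2 3 = true
p5E 3 4 = true
p5E _ _ = false

P5 : Graph
P5 = Small.graph 5 p5E irr
  where
  irr : ∀ (u : Fin 5) → ¬ T (p5E (toℕ u) (toℕ u) ∨ p5E (toℕ u) (toℕ u))
  irr Fin.zero ()
  irr (Fin.suc Fin.zero) ()
  irr (Fin.suc (Fin.suc Fin.zero)) ()
  irr (Fin.suc (Fin.suc (Fin.suc Fin.zero))) ()
  irr (Fin.suc (Fin.suc (Fin.suc (Fin.suc Fin.zero)))) ()

bannerE : ℕ → ℕ → Bool
bannerE 0 1 = true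
bannerE 1 2 = true
bannerE 2 3 = true
bannerE 3 0 = true
bannerE 0 4 = true
bannerE _ _ = false

Banner : Graph
Banner = Small.graph 5 bannerE irr
  where
  irr : ∀ (u : Fin 5) → ¬ T (bannerE (toℕ u) (toℕ u) ∨ bannerE (toℕ u) (toℕ u))
  irr Fin.zero ()
  irr (Fin.suc Fin.zero) ()
  irr (Fin.suc (Fin.suc Fin.zero)) ()
  irr (Fin.suc (Fin.suc (Fin.suc Fin.zero))) ()
  irr (Fin.suc (Fin.suc (Fin.suc (Fin.suc Fin.zero)))) ()

Move : (G : Graph) → Vertex G → Vertex G → Set
Move G u v = u ≡ v ⊎ Adj G u v

Caught : (G : Graph) {k : ℕ} → (Fin k → Vertex G) → Vertex G → Set
Caught G {k} c r = ∃ λ (i : Fin k) → c i ≡ r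

-- CopsWinFrom G c r : the cops (at positions c), who are to move, can force
-- capture of the robber (at r) within finitely many rounds.
data CopsWinFrom (G : Graph) {k : ℕ} : (Fin k → Vertex G) → Vertex G → Set where
  move : ∀ {c r} (c′ : Fin k → Vertex G) →
         (∀ i → Move G (c i) (c′ i)) →
         (Caught G c′ r ⊎
          (∀ r′ → Move G r r′ → Caught G c′ r′ ⊎ CopsWinFrom G c′ r′)) →
         CopsWinFrom G c r

CopsWin : ℕ → Graph → Set
CopsWin k G =
  Σ (Fin k → Vertex G) λ c → ∀ (r : Vertex G) → Caught G c r ⊎ CopsWinFrom G c r

-- cop(G) ≤ m  (cop number = least k such that k cops win; for connected G
-- there is a single component)
CopNumber≤ : Graph → ℕ → Set
CopNumber≤ G m = ∃ λ k → k ≤ m × CopsWin k G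

-- Both cops start on a vertex v with a largest closed neighbourhood; the first cop stays there,
-- so the robber is confined to one component C of G − N[v]. Pick s ∈ N(v) with a neighbour
-- in C; maximality of N[v] gives t ∈ N(v) ∖ N[s]. By P5-freeness every vertex of C is within
-- distance two of s through C, and then P5- and banner-freeness make every vertex of C outside
-- N(s) adjacent to t. The second cop goes to s and on through v to t. If the robber survives
-- both visits, C contains a vertex seeing only t and one seeing only s, which by
-- banner-freeness forces C to be a clique, so the second cop walks to a vertex of C and
-- catches the robber.

module Submission where

open import Defs
open import Data.Bool using (true; if_then_else_)
open import Data.Empty using (⊥-elim)
open import Data.Fin using (Fin; Fin′; inject; fromℕ<; _≟_; _<_)
open import Data.Fin.Patterns using (0F; 1F; 2F; 3F; 4F)
open import Data.Fin.Properties using (<-cmp; toℕ-inject; toℕ-fromℕ<; toℕ-injective; ¬∀⟶∃¬)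
open import Data.Fin.Subset using (Subset; _∈_; _⊆_; ∣_∣)
open import Data.Fin.Subset.Properties using (p⊂q⇒∣p∣<∣q∣)
open import Data.List using (allFin)
open import Data.List.Extrema.Nat using (argmax; f[xs]≤f[argmax])
open import Data.List.Membership.Propositional.Properties using (∈-allFin)
import Data.List.Relation.Unary.All as All
open import Data.Nat using (zero; suc; _≤_; z≤n)
open import Data.Nat.Properties using (≤-refl; <⇒≱)
open import Data.Product using (Σ; ∃; ∃₂; _×_; _,_)
open import Data.Sum using (_⊎_; inj₁; inj₂; [_,_]′)
open import Data.Vec using (_∷_; []; lookup; tabulate)
open import Data.Vec.Properties using (lookup∘tabulate; lookup⇒[]=; []=⇒lookup)
open import Function using (_∘_)
open import Relation.Binary using (Decidable; tri<; tri≈; tri>)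
open import Relation.Nullary using (¬_; Dec; yes; no; does; ¬?; contradiction)
open import Relation.Nullary.Decidable using (_⊎-dec_; _→-dec_; dec-true; dec-false; decidable-stable)
open import Relation.Binary.PropositionalEquality
  using (_≡_; _≢_; refl; subst; trans) renaming (sym to sym′)

module _ (G : Graph) where

  Move? : Decidable (Move G)
  Move? x y = (x ≟ y) ⊎-dec adj? G x y

  Move-sym : ∀ {x y} → Move G x y → Move G y x
  Move-sym (inj₁ eq) = inj₁ (sym′ eq)
  Move-sym (inj₂ a)  = inj₂ (sym G a)

  ¬Move-sym : ∀ {x y} → ¬ Move G x y → ¬ Move G y x
  ¬Move-sym ¬m m = ¬m (Move-sym m)

  distinguished : ∀ {x y z} → Adj G z x → ¬ Adj G z y → x ≢ y
  distinguished zx ¬zy refl = ¬zy zx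

module _ (H G : Graph) (f : Vertex H → Vertex G) where

  -- ¬ Move G x y says that x and y are distinct and non-adjacent.
  Faithful : Vertex H → Vertex H → Set
  Faithful i j = if does (adj? H i j) then Adj G (f i) (f j) else ¬ Move G (f i) (f j)

  Faithful-sym : ∀ {i j} → Faithful i j → Faithful j i
  Faithful-sym {i} {j} with adj? H i j | adj? H j i
  ... | yes _  | yes _  = sym G
  ... | no _   | no _   = ¬Move-sym G
  ... | yes ij | no ¬ji = ⊥-elim (¬ji (sym H ij))
  ... | no ¬ij | yes ji = ⊥-elim (¬ij (sym H ji))

  Faithful⇒≢ : ∀ {i j} → Faithful i j → f i ≢ f j
  Faithful⇒≢ {i} {j} with adj? H i j
  ... | yes _ = λ a eq → irrefl G (subst (λ x → Adj G x (f j)) eq a)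
  ... | no _  = λ ¬m eq → ¬m (inj₁ eq)

  faithful⇒inducedSubgraph : (∀ i (j : Fin′ i) → Faithful (inject j) i) → InducedSubgraph H G
  faithful⇒inducedSubgraph faithful↓ = f , injective , λ i j → preserves i j , reflects i j
    where
    inject-fromℕ< : ∀ {i j : Vertex H} (i<j : i < j) → inject {i = j} (fromℕ< i<j) ≡ i
    inject-fromℕ< i<j = toℕ-injective (trans (toℕ-inject (fromℕ< i<j)) (toℕ-fromℕ< i<j))

    faithful : ∀ {i j} → i ≢ j → Faithful i j
    faithful {i} {j} i≢j with <-cmp i j
    ... | tri< i<j _ _ = subst (λ k → Faithful k j) (inject-fromℕ< i<j) (faithful↓ j (fromℕ< i<j))
    ... | tri≈ _ i≡j _ = ⊥-elim (i≢j i≡j)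
    ... | tri> _ _ j<i =
      Faithful-sym (subst (λ k → Faithful k i) (inject-fromℕ< j<i) (faithful↓ i (fromℕ< j<i)))

    injective : ∀ {i j} → f i ≡ f j → i ≡ j
    injective {i} {j} eq with i ≟ j
    ... | yes i≡j = i≡j
    ... | no i≢j  = ⊥-elim (Faithful⇒≢ (faithful i≢j) eq)

    preserves : ∀ i j → Adj H i j → Adj G (f i) (f j)
    preserves i j a with i ≟ j
    ... | yes refl = ⊥-elim (irrefl H a)
    ... | no i≢j with adj? H i j | faithful i≢j
    ...   | yes _ | fij = fij
    ...   | no ¬a | _   = ⊥-elim (¬a a)

    reflects : ∀ i j → Adj G (f i) (f j) → Adj H i j
    reflects i j a with i ≟ j
    ... | yes refl = ⊥-elim (irrefl G a)
    ... | no i≢j with adj? H i j | faithful i≢j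
    ...   | yes h | _    = h
    ...   | no _  | ¬fij = ⊥-elim (¬fij (inj₂ a))

module _ (G : Graph) where

  P5-induced : ∀ {x₀ x₁ x₂ x₃ x₄} →
    Adj G x₀ x₁ → Adj G x₁ x₂ → Adj G x₂ x₃ → Adj G x₃ x₄ →
    ¬ Move G x₀ x₂ → ¬ Move G x₀ x₃ → ¬ Move G x₀ x₄ →
    ¬ Move G x₁ x₃ → ¬ Move G x₁ x₄ → ¬ Move G x₂ x₄ →
    InducedSubgraph P5 G
  P5-induced {x₀} {x₁} {x₂} {x₃} {x₄} e₀₁ e₁₂ e₂₃ e₃₄ n₀₂ n₀₃ n₀₄ n₁₃ n₁₄ n₂₄ =
    faithful⇒inducedSubgraph P5 G f faithful↓
    where
    f : Vertex P5 → Vertex G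
    f = lookup (x₀ ∷ x₁ ∷ x₂ ∷ x₃ ∷ x₄ ∷ [])
    faithful↓ : ∀ i (j : Fin′ i) → Faithful P5 G f (inject j) i
    faithful↓ 0F ()
    faithful↓ 1F 0F = e₀₁
    faithful↓ 2F 0F = n₀₂
    faithful↓ 2F 1F = e₁₂
    faithful↓ 3F 0F = n₀₃
    faithful↓ 3F 1F = n₁₃
    faithful↓ 3F 2F = e₂₃
    faithful↓ 4F 0F = n₀₄
    faithful↓ 4F 1F = n₁₄
    faithful↓ 4F 2F = n₂₄
    faithful↓ 4F 3F = e₃₄

  Banner-induced : ∀ {x₀ x₁ x₂ x₃ x₄} →
    Adj G x₀ x₁ → Adj G x₁ x₂ → Adj G x₂ x₃ → Adj G x₀ x₃ → Adj G x₀ x₄ →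
    ¬ Move G x₀ x₂ → ¬ Move G x₁ x₃ → ¬ Move G x₁ x₄ → ¬ Move G x₂ x₄ → ¬ Move G x₃ x₄ →
    InducedSubgraph Banner G
  Banner-induced {x₀} {x₁} {x₂} {x₃} {x₄} e₀₁ e₁₂ e₂₃ e₀₃ e₀₄ n₀₂ n₁₃ n₁₄ n₂₄ n₃₄ =
    faithful⇒inducedSubgraph Banner G f faithful↓
    where
    f : Vertex Banner → Vertex G
    f = lookup (x₀ ∷ x₁ ∷ x₂ ∷ x₃ ∷ x₄ ∷ [])
    faithful↓ : ∀ i (j : Fin′ i) → Faithful Banner G f (inject j) i
    faithful↓ 0F ()
    faithful↓ 1F 0F = e₀₁
    faithful↓ 2F 0F = n₀₂
    faithful↓ 2F 1F = e₁₂
    faithful↓ 3F 0F = e₀₃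
    faithful↓ 3F 1F = n₁₃
    faithful↓ 3F 2F = e₂₃
    faithful↓ 4F 0F = e₀₄
    faithful↓ 4F 1F = n₁₄
    faithful↓ 4F 2F = n₂₄
    faithful↓ 4F 3F = n₃₄

module _ (G : Graph) where

  N[_] : Vertex G → Subset (n G)
  N[ v ] = tabulate (λ u → does (Move? G v u))

  Move⇒∈N[] : ∀ {v u} → Move G v u → u ∈ N[ v ]
  Move⇒∈N[] {v} {u} vu =
    lookup⇒[]= u N[ v ] (trans (lookup∘tabulate _ u) (dec-true (Move? G v u) vu))

  ∈N[]⇒Move : ∀ {v u} → u ∈ N[ v ] → Move G v u
  ∈N[]⇒Move {v} {u} u∈N[v] = decidable-stable (Move? G v u) λ ¬vu →
    contradiction (trans (sym′ (dec-false (Move? G v u) ¬vu)) marked) λ ()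
    where
    marked : does (Move? G v u) ≡ true
    marked = trans (sym′ (lookup∘tabulate _ u)) ([]=⇒lookup u∈N[v])

  largestClosedNeighbourhood : Vertex G → Σ (Vertex G) λ v → ∀ u → ∣ N[ u ] ∣ ≤ ∣ N[ v ] ∣
  largestClosedNeighbourhood v₀ =
    v , λ u → All.lookup (f[xs]≤f[argmax] v₀ (allFin (n G))) (∈-allFin u)
    where
    v : Vertex G
    v = argmax (λ u → ∣ N[ u ] ∣) v₀ (allFin (n G))

  -- Maximality of N[v] forbids N[v] ⊂ N[s], and c ∈ N[s] ∖ N[v] would make the inclusion strict.
  privateNeighbour : ∀ {v s c} → (∀ u → ∣ N[ u ] ∣ ≤ ∣ N[ v ] ∣) →
                     Adj G v s → Adj G s c → ¬ Move G v c →
                     ∃ λ t → Adj G v t × ¬ Move G s t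
  privateNeighbour {v} {s} {c} maximal vs sc ¬vc =
    witness (¬∀⟶∃¬ (n G) _ (λ u → Move? G v u →-dec Move? G s u) ¬N[v]⊆N[s])
    where
    ¬N[v]⊆N[s] : ¬ (∀ u → Move G v u → Move G s u)
    ¬N[v]⊆N[s] v⇒s =
      <⇒≱ (p⊂q⇒∣p∣<∣q∣ (N[v]⊆N[s] , c , Move⇒∈N[] (inj₂ sc) , ¬vc ∘ ∈N[]⇒Move)) (maximal s)
      where
      N[v]⊆N[s] : N[ v ] ⊆ N[ s ]
      N[v]⊆N[s] {u} = Move⇒∈N[] ∘ v⇒s u ∘ ∈N[]⇒Move

    witness : (∃ λ u → ¬ (Move G v u → Move G s u)) → ∃ λ t → Adj G v t × ¬ Move G s t
    witness (u , ¬v⇒s) with Move? G v u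
    ... | no ¬vu          = ⊥-elim (¬v⇒s (⊥-elim ∘ ¬vu))
    ... | yes (inj₁ refl) = ⊥-elim (¬v⇒s (λ _ → inj₂ (sym G vs)))
    ... | yes (inj₂ vu)   = u , vu , λ su → ¬v⇒s (λ _ → su)

module _ (G : Graph) (P : Vertex G → Set) where

  data WalkIn : Vertex G → Vertex G → Set where
    here : ∀ {x} → P x → WalkIn x x
    step : ∀ {x y z} → P x → Adj G x y → WalkIn y z → WalkIn x z

  WalkIn-start : ∀ {x y} → WalkIn x y → P x
  WalkIn-start (here Px)     = Px
  WalkIn-start (step Px _ _) = Px

  WalkIn-end : ∀ {x y} → WalkIn x y → P y
  WalkIn-end (here Py)       = Py
  WalkIn-end (step _ _ rest) = WalkIn-end rest

  leave : (∀ x → Dec (P x)) → ∀ {x y} → Walk G x y → P x → ¬ P y →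
          ∃₂ λ c w → WalkIn x c × Adj G c w × ¬ P w
  leave P? here                   Px ¬Py = ⊥-elim (¬Py Px)
  leave P? (step {w = w} xw walk) Px ¬Py with P? w
  ... | no ¬Pw = _ , w , here Px , xw , ¬Pw
  ... | yes Pw with leave P? walk Pw ¬Py
  ...   | c , w′ , wc , cw′ , ¬Pw′ = c , w′ , step Px xw wc , cw′ , ¬Pw′

module FreeGraph (G : Graph) (p5-free : Free P5 G) (banner-free : Free Banner G) (v : Vertex G) where

  Outside : Vertex G → Set
  Outside x = ¬ Move G v x

  outside-¬Move : ∀ {x y} → Adj G v y → Outside x → ¬ Adj G y x → ¬ Move G y x
  outside-¬Move vy out-x ¬yx = [ (λ { refl → out-x (inj₂ vy) }) , ¬yx ]′

  SeesOnly : Vertex G → Vertex G → Vertex G → Set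
  SeesOnly p q y = Outside y × Adj G p y × ¬ Adj G q y

  SeesBoth : Vertex G → Vertex G → Vertex G → Set
  SeesBoth p q y = Outside y × Adj G p y × Adj G q y

  module NonAdjacentNeighbours {p q} (vp : Adj G v p) (vq : Adj G v q) (¬pq : ¬ Move G p q) where

    cross-adjacent : ∀ {a b} → SeesOnly p q a → SeesOnly q p b → Adj G a b
    cross-adjacent {a} {b} (out-a , pa , ¬qa) (out-b , qb , ¬pb) =
      decidable-stable (adj? G a b) λ ¬ab → p5-free (P5-induced G (sym G pa) (sym G vp) vq qb
        (¬Move-sym G out-a) (¬Move-sym G (outside-¬Move vq out-a ¬qa)) [ distinguished G pa ¬pb , ¬ab ]′
        ¬pq (outside-¬Move vp out-b ¬pb) out-b)

    seesBoth-adjacent : ∀ {a y} → SeesBoth p q a → SeesOnly p q y → Adj G a y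
    seesBoth-adjacent {a} {y} (out-a , pa , qa) (out-y , py , ¬qy) =
      decidable-stable (adj? G a y) λ ¬ay → banner-free (Banner-induced G (sym G vp) vq qa pa py
        ¬pq out-a out-y (outside-¬Move vq out-y ¬qy) [ distinguished G qa ¬qy , ¬ay ]′)

    seesOnly-clique : ∀ {w y y′} → SeesOnly q p w →
                      SeesOnly p q y → SeesOnly p q y′ → y ≢ y′ → Adj G y y′
    seesOnly-clique {y = y} {y′} Sw@(out-w , qw , ¬pw) Sy@(out-y , py , ¬qy) Sy′@(out-y′ , py′ , ¬qy′) y≢y′ =
      decidable-stable (adj? G y y′) λ ¬yy′ →
        banner-free (Banner-induced G
          (sym G (cross-adjacent Sy Sw)) (sym G py) py′ (sym G (cross-adjacent Sy′ Sw)) (sym G qw)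
          (¬Move-sym G (outside-¬Move vp out-w ¬pw)) [ y≢y′ , ¬yy′ ]′
          (¬Move-sym G (outside-¬Move vq out-y ¬qy)) ¬pq (¬Move-sym G (outside-¬Move vq out-y′ ¬qy′)))

    seesBoth-clique : ∀ {w a a′} → SeesOnly p q w →
                      SeesBoth p q a → SeesBoth p q a′ → a ≢ a′ → Adj G a a′
    seesBoth-clique {a = a} {a′} Sw@(out-w , _ , ¬qw) Ba@(out-a , _ , qa) Ba′@(out-a′ , _ , qa′) a≢a′ =
      decidable-stable (adj? G a a′) λ ¬aa′ →
        banner-free (Banner-induced G
          qa (seesBoth-adjacent Ba Sw) (sym G (seesBoth-adjacent Ba′ Sw)) qa′ (sym G vq)
          (outside-¬Move vq out-w ¬qw) [ a≢a′ , ¬aa′ ]′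
          (¬Move-sym G out-a) (¬Move-sym G out-w) (¬Move-sym G out-a′))

  module Component {s c} (vs : Adj G v s) (sc : Adj G s c) where

    Reaches : Vertex G → Set
    Reaches x = WalkIn G Outside x c

    reaches⇒outside : ∀ {x} → Reaches x → Outside x
    reaches⇒outside = WalkIn-start G Outside

    withinTwoStepsOfS : ∀ {w} → Reaches w → Adj G s w ⊎ ∃ λ a → Outside a × Adj G s a × Adj G a w
    withinTwoStepsOfS (here _) = inj₁ sc
    withinTwoStepsOfS {w} (step {y = w′} out-w ww′ rest)
      with adj? G s w | adj? G s w′ | withinTwoStepsOfS rest
    ... | yes sw  | _        | _  = inj₁ sw
    ... | no _    | yes sw′  | _  = inj₂ (w′ , reaches⇒outside rest , sw′ , sym G ww′)
    ... | no _    | no ¬sw′  | inj₁ sw′ = ⊥-elim (¬sw′ sw′)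
    ... | no ¬sw  | no ¬sw′  | inj₂ (a , out-a , sa , aw′) =
      inj₂ (a , out-a , sa , decidable-stable (adj? G a w) λ ¬aw →
        p5-free (P5-induced G vs sa aw′ (sym G ww′)
          out-a out-w′ out-w (outside-¬Move vs out-w′ ¬sw′) (outside-¬Move vs out-w ¬sw)
          [ distinguished G sa ¬sw , ¬aw ]′))
      where
      out-w′ : Outside w′
      out-w′ = reaches⇒outside rest

    module _ {t} (vt : Adj G v t) (¬st : ¬ Move G s t) where

      dominated : ∀ {b} → Reaches b → ¬ Adj G s b → Adj G t b
      dominated {b} rb ¬sb with withinTwoStepsOfS rb
      ... | inj₁ sb = ⊥-elim (¬sb sb)
      ... | inj₂ (a , out-a , sa , ab) = decidable-stable (adj? G t b) (P5-or-banner (adj? G t a))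
        where
        out-b : Outside b
        out-b = reaches⇒outside rb
        P5-or-banner : Dec (Adj G t a) → ¬ ¬ Adj G t b
        P5-or-banner (yes ta) ¬tb = banner-free (Banner-induced G (sym G sa) (sym G vs) vt (sym G ta) ab
          (¬Move-sym G out-a) ¬st (outside-¬Move vs out-b ¬sb) out-b (outside-¬Move vt out-b ¬tb))
        P5-or-banner (no ¬ta) ¬tb = p5-free (P5-induced G (sym G vt) vs sa ab
          (¬Move-sym G ¬st) (outside-¬Move vt out-a ¬ta) (outside-¬Move vt out-b ¬tb)
          out-a out-b (outside-¬Move vs out-b ¬sb))

      private
        module ST = NonAdjacentNeighbours vs vt ¬st
        module TS = NonAdjacentNeighbours vt vs (¬Move-sym G ¬st)

        swap : ∀ {y} → SeesBoth s t y → SeesBoth t s y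
        swap (out , sy , ty) = out , ty , sy

      data Side (y : Vertex G) : Set where
        onlyS : SeesOnly s t y → Side y
        both  : SeesBoth s t y → Side y
        onlyT : SeesOnly t s y → Side y

      side : ∀ {y} → Reaches y → Side y
      side {y} ry with adj? G s y | adj? G t y
      ... | yes sy | no ¬ty = onlyS (reaches⇒outside ry , sy , ¬ty)
      ... | yes sy | yes ty = both (reaches⇒outside ry , sy , ty)
      ... | no ¬sy | _      = onlyT (reaches⇒outside ry , dominated ry ¬sy , ¬sy)

      -- The three sides are cliques and pairwise complete; b and x are the witnesses that the
      -- banner arguments for the cliques need.
      clique : ∀ {b x} → SeesOnly t s b → SeesOnly s t x →
               ∀ {y z} → Reaches y → Reaches z → y ≢ z → Adj G y z
      clique Sb Sx ry rz y≢z with side ry | side rz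
      ... | onlyS Sy | onlyS Sz = ST.seesOnly-clique Sb Sy Sz y≢z
      ... | onlyS Sy | both Bz  = sym G (ST.seesBoth-adjacent Bz Sy)
      ... | onlyS Sy | onlyT Tz = ST.cross-adjacent Sy Tz
      ... | both By  | onlyS Sz = ST.seesBoth-adjacent By Sz
      ... | both By  | both Bz  = ST.seesBoth-clique Sx By Bz y≢z
      ... | both By  | onlyT Tz = TS.seesBoth-adjacent (swap By) Tz
      ... | onlyT Ty | onlyS Sz = TS.cross-adjacent Ty Sz
      ... | onlyT Ty | both Bz  = sym G (TS.seesBoth-adjacent (swap Bz) Ty)
      ... | onlyT Ty | onlyT Tz = TS.seesOnly-clique Sx Ty Tz y≢z

module TwoCops (G : Graph) where

  cops : Vertex G → Vertex G → Fin 2 → Vertex G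
  cops a b 0F = a
  cops a b 1F = b

  capture₁ : ∀ {a b x} → Move G a x → CopsWinFrom G (cops a b) x
  capture₁ {a} {b} {x} ax = move (cops x b) moves (inj₁ (0F , refl))
    where
    moves : ∀ i → Move G (cops a b i) (cops x b i)
    moves 0F = ax
    moves 1F = inj₁ refl

  capture₂ : ∀ {a b x} → Move G b x → CopsWinFrom G (cops a b) x
  capture₂ {a} {b} {x} bx = move (cops a x) moves (inj₁ (1F , refl))
    where
    moves : ∀ i → Move G (cops a b i) (cops a x i)
    moves 0F = inj₁ refl
    moves 1F = bx

  -- While the first cop stays on v, a robber in R can never step into N[v] without being caught.
  module Guard (v : Vertex G) (R : Vertex G → Set)
               (R-closed : ∀ {x y} → R x → Adj G x y → ¬ Move G v y → R y) where

    approach : ∀ {b d} → Walk G b d → (∀ {x} → R x → CopsWinFrom G (cops v d) x) →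
               ∀ {x} → R x → CopsWinFrom G (cops v b) x
    approach here                    win = win
    approach {b} (step {w = b′} bb′ walk) win {x} Rx = move (cops v b′) moves (inj₂ respond)
      where
      moves : ∀ i → Move G (cops v b i) (cops v b′ i)
      moves 0F = inj₁ refl
      moves 1F = inj₂ bb′
      respond : ∀ x′ → Move G x x′ → Caught G (cops v b′) x′ ⊎ CopsWinFrom G (cops v b′) x′
      respond x′ (inj₁ refl) = inj₂ (approach walk win Rx)
      respond x′ (inj₂ xx′) with Move? G v x′
      ... | yes vx′ = inj₂ (capture₁ vx′)
      ... | no ¬vx′ = inj₂ (approach walk win (R-closed Rx xx′ ¬vx′))

module Strategy (G : Graph) (connected : Connected G) (p5-free : Free P5 G) (banner-free : Free Banner G)
                {v : Vertex G} (maximal : ∀ u → ∣ N[_] G u ∣ ≤ ∣ N[_] G v ∣) where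
  open FreeGraph G p5-free banner-free v
  open TwoCops G

  module Chase {s c t} (vs : Adj G v s) (sc : Adj G s c) (out-c : Outside c)
               (vt : Adj G v t) (¬st : ¬ Move G s t) where
    open Component vs sc
    open Guard v Reaches (λ rx xy out-y → step out-y (sym G xy) rx)

    winAt-c : (∀ {y z} → Reaches y → Reaches z → y ≢ z → Adj G y z) →
            ∀ {z} → Reaches z → CopsWinFrom G (cops v c) z
    winAt-c clique-C {z} rz with c ≟ z
    ... | yes c≡z = capture₂ (inj₁ c≡z)
    ... | no c≢z  = capture₂ (inj₂ (clique-C (here out-c) rz c≢z))

    winAt-t : ∀ {b} → SeesOnly t s b → ∀ {x} → Reaches x → CopsWinFrom G (cops v t) x
    winAt-t Sb {x} rx with adj? G t x
    ... | yes tx = capture₂ (inj₂ tx)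
    ... | no ¬tx = approach (connected t c) (winAt-c (clique vt ¬st Sb Sx)) rx
      where
      Sx : SeesOnly s t x
      Sx = reaches⇒outside rx , decidable-stable (adj? G s x) (¬tx ∘ dominated vt ¬st rx) , ¬tx

    winAt-s : ∀ {x} → Reaches x → CopsWinFrom G (cops v s) x
    winAt-s {x} rx with adj? G s x
    ... | yes sx = capture₂ (inj₂ sx)
    ... | no ¬sx = approach (step (sym G vs) (step vt here))
                     (winAt-t (reaches⇒outside rx , dominated vt ¬st rx ¬sx , ¬sx)) rx

    winAt-v : ∀ {x} → Reaches x → CopsWinFrom G (cops v v) x
    winAt-v = approach (step vs here) winAt-s

  adjacentOnEntry : ∀ {c w} → Outside c → Adj G c w → ¬ Outside w → Adj G v w
  adjacentOnEntry out-c cw ¬out-w with decidable-stable (Move? G v _) ¬out-w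
  ... | inj₁ refl = ⊥-elim (out-c (inj₂ (sym G cw)))
  ... | inj₂ vw   = vw

  chase : ∀ {r s c} → WalkIn G Outside r c → Adj G v s → Adj G s c → CopsWinFrom G (cops v v) r
  chase rc vs sc with privateNeighbour G maximal vs sc (WalkIn-end G Outside rc)
  ... | t , vt , ¬st = Chase.winAt-v vs sc (WalkIn-end G Outside rc) vt ¬st rc

  robberLoses : ∀ r → Caught G (cops v v) r ⊎ CopsWinFrom G (cops v v) r
  robberLoses r with Move? G v r
  ... | yes (inj₁ refl) = inj₁ (0F , refl)
  ... | yes (inj₂ vr)   = inj₂ (capture₁ (inj₂ vr))
  ... | no out-r with leave G Outside (¬? ∘ Move? G v) (connected r v) out-r (λ out-v → out-v (inj₁ refl))
  ...   | c , s , rc , cs , ¬out-s =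
    inj₂ (chase rc (adjacentOnEntry (WalkIn-end G Outside rc) cs ¬out-s) (sym G cs))

twoCopsWin : (G : Graph) → Connected G → Free P5 G → Free Banner G → Vertex G → CopsWin 2 G
twoCopsWin G connected p5-free banner-free v₀ with largestClosedNeighbourhood G v₀
... | v , maximal = TwoCops.cops G v v , Strategy.robberLoses G connected p5-free banner-free maximal

empty⊎inhabited : ∀ m → ¬ Fin m ⊎ Fin m
empty⊎inhabited zero    = inj₁ λ ()
empty⊎inhabited (suc m) = inj₂ 0F

corollary2p2 : (G : Graph) → Connected G → Free P5 G → Free Banner G → CopNumber≤ G 2
corollary2p2 G connected p5-free banner-free with empty⊎inhabited (n G)
... | inj₁ empty = 0 , z≤n , (λ ()) , ⊥-elim ∘ empty
... | inj₂ v₀    = 2 , ≤-refl , twoCopsWin G connected p5-free banner-free v₀
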